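{- Let $T$ be a quasi-binary tree with $|V(T)|>1$ and a weight function $\omega: V(T)\to\mathbb{R}$. Let $\gamma,\eta\in\mathbb{R}$ with $\gamma\ge\omega_3$ and $$\max\left\{\frac{\omega_1-\gamma}{2},\ \omega_2-\gamma\right\}\le \eta\le \frac{\omega(T)}{2}.$$ Then there exists an edge $e\in E(T)$ such that, denoting by $C_e^1, C_e^2$ the two connected components of $T\setminus\{e\}$, one has $\eta\le \omega(C_e^i)\le 2\eta+\gamma$ for some $i\in\{1,2\}$.
   Context: A binary tree is a tree in which every vertex has degree $3$, except for pending vertices (degree $1$) and one root vertex (degree $2$). A tree is quasi-binary if it is a connected subgraph of a binary tree; hence every vertex of a quasi-binary tree $T$ has degree $1$, $2$ or $3$ in $T$. For $i=1,2,3$ let $V_i=\{v\in V(T): d_T(v)=i\}$ and $\omega_i=\max\{\omega(v): v\in V_i\cup\dots\cup V_3\}$ (so $\omega_1=\max$ over all vertices, $\omega_2=\max$ over vertices of degree $2$ or $3$, $\omega_3=\max$ over vertices of degree $3$; a maximum over an empty set is taken as $-\infty$). For a subgraph $C$, $\omega(C)=\sum_{v\in V(C)}\omega(v)$. -}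

module Defs where

open import Level using (Level; suc; _⊔_)
open import Data.Nat as ℕ using (ℕ)
open import Data.Bool using (Bool; true; false; if_then_else_)
open import Data.Fin using (Fin)
open import Data.List using (List; []; _∷_; _++_; [_]; length; foldr; map; allFin)
open import Data.List.Relation.Unary.Linked using (Linked)
open import Data.List.Relation.Unary.Unique.Propositional using (Unique)
open import Data.Product using (Σ; ∃; _×_; _,_)
open import Data.Sum using (_⊎_)
open import Relation.Nullary using (¬_)
open import Relation.Binary.PropositionalEquality using (_≡_)
open import Relation.Binary.Construct.Closure.ReflexiveTransitive using (Star)
open import Relation.Binary.Structures using (IsTotalOrder)
open import Algebra.Bundles using (CommutativeRing)

-- Weights: a linearly ordered commutative ring (ℝ is an instance).

record OrderedCommRing (c ℓ ℓ₂ : Level) : Set (Level.suc (c ⊔ ℓ ⊔ ℓ₂)) where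
  field
    commRing : CommutativeRing c ℓ
  open CommutativeRing commRing public
  field
    _≤_          : Carrier → Carrier → Set ℓ₂
    isTotalOrder : IsTotalOrder _≈_ _≤_
    +-monoʳ-≤    : ∀ {x y} z → x ≤ y → (x + z) ≤ (y + z)
    *-nonneg     : ∀ {x y} → 0# ≤ x → 0# ≤ y → 0# ≤ (x * y)

record Graph (n : ℕ) : Set where
  field
    adj   : Fin n → Fin n → Bool
    sym   : ∀ u v → adj u v ≡ adj v u
    irrefl : ∀ v → adj v v ≡ false

module _ {n : ℕ} (G : Graph n) where
  open Graph G

  Adj : Fin n → Fin n → Set
  Adj u v = adj u v ≡ true

  deg : Fin n → ℕ
  deg v = foldr ℕ._+_ 0 (map (λ w → if adj v w then 1 else 0) (allFin n))

  Connected : Set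
  Connected = ∀ u v → Star Adj u v

  IsCycle : List (Fin n) → Set
  IsCycle []       = Data.Empty.⊥ where import Data.Empty
  IsCycle (x ∷ ys) = (2 ℕ.≤ length ys) × Unique (x ∷ ys) × Linked Adj (x ∷ ys ++ [ x ])

  Acyclic : Set
  Acyclic = ∀ vs → ¬ IsCycle vs

  IsTree : Set
  IsTree = Connected × Acyclic

  IsBinaryTree : Set
  IsBinaryTree = IsTree × Σ (Fin n) λ r → deg r ≡ 2 ×
                 (∀ v → ¬ (v ≡ r) → deg v ≡ 1 ⊎ deg v ≡ 3)

  AdjWithout : Fin n → Fin n → Fin n → Fin n → Set
  AdjWithout a b x y = Adj x y × ¬ ((x ≡ a × y ≡ b) ⊎ (x ≡ b × y ≡ a))

-- quasi-binary tree: a tree isomorphic to a connected subgraph of some binary tree.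
-- (In a tree, a connected subgraph on vertex set S is the induced subgraph on S,
--  so we ask for an injective map whose adjacency is reflected and preserved.)
IsQuasiBinaryTree : ∀ {n} → Graph n → Set
IsQuasiBinaryTree {n} T =
  IsTree T × Σ ℕ λ m → Σ (Graph m) λ B → IsBinaryTree B ×
    Σ (Fin n → Fin m) λ f → (∀ u v → f u ≡ f v → u ≡ v) ×
      (∀ u v → Graph.adj T u v ≡ Graph.adj B (f u) (f v))

module _ {c ℓ ℓ₂} (R : OrderedCommRing c ℓ ℓ₂) where
  open OrderedCommRing R

  weightOf : ∀ {n} → (Fin n → Carrier) → (Fin n → Bool) → Carrier
  weightOf {n} ω S = foldr _+_ 0# (map (λ v → if S v then ω v else 0#) (allFin n))

  totalWeight : ∀ {n} → (Fin n → Carrier) → Carrier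
  totalWeight ω = weightOf ω (λ _ → true)

  -- "ω_i ≤ c": the maximum of ω over vertices of degree ≥ i is at most c
  -- (with max ∅ = -∞ this holds vacuously when there is no such vertex)
  ωBoundedBy : ∀ {n} → Graph n → (Fin n → Carrier) → ℕ → Carrier → Set (ℓ₂)
  ωBoundedBy G ω i b = ∀ v → i ℕ.≤ deg G v → ω v ≤ b

module Submission where

-- For an edge uv let Side u v be the vertices reachable from u in T − uv and
-- W u v their weight.  The two sides of an edge partition V(T), so
-- W u v + W v u = ω(T) ≥ 2η and one orientation of every edge is heavy
-- (W u v ≥ η).  The side of uv is u together with the disjoint sides of the
-- edges cu, c ranging over the children c ≠ v of u, so
--     W u v = ω(u) + Σ_c W c u,
-- and each child side is strictly smaller.  Starting from a heavy edge we move
-- into a heavy child side as long as there is one.  Where this stops, all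
-- children are light (W c u ≤ η); u has at most two children and degree
-- 1 + #children, and the hypotheses ω₁ ≤ 2η + γ, ω₂ ≤ η + γ, ω₃ ≤ γ give
-- W u v ≤ 2η + γ in each case.

open import Defs

open import Level using (0ℓ; _⊔_)
open import Function using (_∘_; id)
open import Function.Bundles using (Equivalence)
open import Data.Empty using (⊥)
open import Data.Product using (Σ; ∃-syntax; _×_; _,_; proj₁; proj₂)
open import Data.Sum as Sum using (_⊎_; inj₁; inj₂)
open import Data.Bool using (Bool; true; false; if_then_else_)
open import Data.Bool.Properties as Bool using (T-≡)
open import Data.Nat as ℕ using (ℕ; zero; suc; _<_; z≤n; s≤s)
import Data.Nat.Properties as ℕ
import Data.Nat.Induction as ℕ
open import Data.Fin as Fin using (Fin)
import Data.Fin.Properties as Fin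
open import Data.List using (List; []; _∷_; _++_; [_]; length; foldr; map; allFin; lookup; filter; filterᵇ)
open import Data.List.Properties using (length-tabulate; length-map)
open import Data.List.Relation.Unary.All as All using (All; []; _∷_)
import Data.List.Relation.Unary.All.Properties as All
open import Data.List.Relation.Unary.Any using (here; there; index; any?)
open import Data.List.Relation.Unary.Linked as Linked using (Linked; [-]; _∷_)
open import Data.List.Relation.Unary.Unique.Propositional using (Unique; []; _∷_)
import Data.List.Relation.Unary.Unique.Propositional.Properties as Unique
open import Data.List.Membership.Propositional using (_∈_)
open import Data.List.Membership.Propositional.Properties using (∈-lookup; ∈-allFin; ∈-filter⁺; ∈-filter⁻)
import Data.List.Membership.Setoid.Properties as SetoidMembership
open import Data.List.Relation.Binary.Subset.Propositional using (_⊆_)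
open import Relation.Nullary using (¬_; Dec; yes; no; does; contradiction)
open import Relation.Nullary.Decidable using (_⊎-dec_; _×-dec_; ¬?; map′; T?; dec-true; dec-false)
open import Relation.Unary using (Pred)
open import Relation.Binary using (Rel; Decidable; DecidableEquality; TotalOrder)
open import Relation.Binary.PropositionalEquality as ≡ using (_≡_; _≢_; refl)
open import Relation.Binary.Construct.Closure.ReflexiveTransitive as Star using (Star; ε; _◅_; _◅◅_)
open import Induction.WellFounded using (Acc; acc)
open import Algebra.Bundles using (CommutativeMonoid)

module ListSum {c ℓ} (M : CommutativeMonoid c ℓ) where
  open CommutativeMonoid M using (Carrier; _≈_; setoid; ∙-cong; ∙-congˡ; ∙-congʳ; identityˡ; identityʳ; commutativeSemigroup)
    renaming (_∙_ to _+_; ε to 0#)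
  open CommutativeMonoid M using () renaming (refl to ≈-refl; sym to ≈-sym; trans to ≈-trans)
  open import Relation.Binary.Reasoning.Setoid setoid
  open import Algebra.Properties.CommutativeSemigroup commutativeSemigroup using (interchange)

  sumOver : ∀ {a} {A : Set a} → List A → (A → Carrier) → Carrier
  sumOver L f = foldr _+_ 0# (map f L)

  module _ {a} {A : Set a} where

    sumOver-cong : ∀ (L : List A) {f g : A → Carrier} →
                   (∀ x → f x ≈ g x) → sumOver L f ≈ sumOver L g
    sumOver-cong []      f≈g = ≈-refl
    sumOver-cong (x ∷ L) f≈g = ∙-cong (f≈g x) (sumOver-cong L f≈g)

    sumOver-+ : ∀ (L : List A) (f g : A → Carrier) →
                sumOver L (λ x → f x + g x) ≈ sumOver L f + sumOver L g
    sumOver-+ []      f g = ≈-sym (identityˡ 0#)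
    sumOver-+ (x ∷ L) f g = begin
      (f x + g x) + sumOver L (λ x → f x + g x) ≈⟨ ∙-congˡ (sumOver-+ L f g) ⟩
      (f x + g x) + (sumOver L f + sumOver L g) ≈⟨ interchange _ _ _ _ ⟩
      (f x + sumOver L f) + (g x + sumOver L g) ∎

    sumOver-0 : ∀ (L : List A) {f : A → Carrier} →
                (∀ {y} → y ∈ L → f y ≈ 0#) → sumOver L f ≈ 0#
    sumOver-0 []      _    = ≈-refl
    sumOver-0 (x ∷ L) f≈0 = ≈-trans (∙-cong (f≈0 (here refl)) (sumOver-0 L (f≈0 ∘ there))) (identityˡ 0#)

    sumOver-single : ∀ {L : List A} {f : A → Carrier} {x : A} → Unique L → x ∈ L →
                     (∀ {y} → y ∈ L → y ≢ x → f y ≈ 0#) → sumOver L f ≈ f x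
    sumOver-single {y ∷ L} (y∉L ∷ _) (here refl) f≈0 =
      ≈-trans (∙-congˡ (sumOver-0 L (λ z∈L → f≈0 (there z∈L) (λ z≡y → All.lookup y∉L z∈L (≡.sym z≡y)))))
              (identityʳ _)
    sumOver-single {y ∷ L} (y∉L ∷ L!) (there x∈L) f≈0 =
      ≈-trans (∙-congʳ (f≈0 (here refl) (All.lookup y∉L x∈L)))
              (≈-trans (identityˡ _) (sumOver-single L! x∈L (f≈0 ∘ there)))

  sumOver-swap : ∀ {a b} {A : Set a} {B : Set b} (L : List A) (K : List B) (f : A → B → Carrier) →
                 sumOver L (λ x → sumOver K (f x)) ≈ sumOver K (λ y → sumOver L (λ x → f x y))
  sumOver-swap L []      f = sumOver-0 L (λ _ → ≈-refl)
  sumOver-swap L (y ∷ K) f = begin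
    sumOver L (λ x → f x y + sumOver K (f x))                 ≈⟨ sumOver-+ L (λ x → f x y) _ ⟩
    sumOver L (λ x → f x y) + sumOver L (λ x → sumOver K (f x)) ≈⟨ ∙-congˡ (sumOver-swap L K f) ⟩
    sumOver L (λ x → f x y) + sumOver K (λ y → sumOver L (λ x → f x y)) ∎

unique-lookup-injective : ∀ {a} {A : Set a} {L : List A} → Unique L →
                          ∀ i j → lookup L i ≡ lookup L j → i ≡ j
unique-lookup-injective (_ ∷ _)    Fin.zero    Fin.zero    _ = refl
unique-lookup-injective (x∉L ∷ _)  Fin.zero    (Fin.suc j) e = contradiction e (All.lookup x∉L (∈-lookup j))
unique-lookup-injective (x∉L ∷ _)  (Fin.suc i) Fin.zero    e = contradiction (≡.sym e) (All.lookup x∉L (∈-lookup i))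
unique-lookup-injective (_ ∷ L!)   (Fin.suc i) (Fin.suc j) e = ≡.cong Fin.suc (unique-lookup-injective L! i j e)

-- A duplicate-free list contained in M is no longer than M: sending each
-- position of L to the position of its entry in M is injective.
unique-⊆-length : ∀ {a} {A : Set a} {L M : List A} → Unique L → L ⊆ M → length L ℕ.≤ length M
unique-⊆-length {A = A} {L} {M} L! L⊆M = Fin.injective⇒≤ position-injective
  where
  position : Fin (length L) → Fin (length M)
  position i = index (L⊆M (∈-lookup i))
  position-injective : ∀ {i j} → position i ≡ position j → i ≡ j
  position-injective {i} {j} e = unique-lookup-injective L! i j
    (SetoidMembership.index-injective (≡.setoid A) (L⊆M (∈-lookup i)) (L⊆M (∈-lookup j)) e)

invariant-along : ∀ {a r p} {A : Set a} {R : Rel A r} {P : Pred A p} →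
                  (∀ {x y} → P x → R x y → P y) → ∀ {x y} → P x → Star R x y → P y
invariant-along {P = P} step {x} = Star.gfoldl id (λ _ → P) step {i = x}

data EndsAt {a} {A : Set a} : List A → A → Set a where
  end  : ∀ {y} → EndsAt [ y ] y
  more : ∀ {x z zs y} → EndsAt (z ∷ zs) y → EndsAt (x ∷ z ∷ zs) y

linked-snoc : ∀ {a r} {A : Set a} {R : Rel A r} {L y z} → Linked R L → EndsAt L y → R y z → Linked R (L ++ [ z ])
linked-snoc [-]      end      r = r ∷ [-]
linked-snoc (r′ ∷ l) (more e) r = r′ ∷ linked-snoc l e r

module SimplePaths {a r} {A : Set a} (_≟_ : DecidableEquality A) (R : Rel A r) where

  record SimplePath (s y : A) : Set (a ⊔ r) where
    constructor simplePath
    field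
      rest   : List A
      linked : Linked R (s ∷ rest)
      unique : Unique (s ∷ rest)
      endsAt : EndsAt (s ∷ rest) y

  suffix : ∀ {s y L} → s ∈ L → Linked R L → Unique L → EndsAt L y → SimplePath s y
  suffix {L = _ ∷ xs}     (here refl) l u e        = simplePath xs l u e
  suffix {L = _ ∷ _ ∷ _}  (there s∈L) (_ ∷ l) (_ ∷ u) (more e) = suffix s∈L l u e

  -- loop removal: prepend the first step unless its source already occurs later
  shorten : ∀ {s y} → Star R s y → SimplePath s y
  shorten ε = simplePath [] [-] ([] ∷ []) end
  shorten {s} (_◅_ {j = t} r w) with shorten w
  ... | simplePath xs l u e with any? (s ≟_) (t ∷ xs)
  ...   | yes s∈ = suffix s∈ l u e
  ...   | no  s∉ = simplePath (t ∷ xs) (r ∷ l) (All.¬Any⇒All¬ (t ∷ xs) s∉ ∷ u) (more e)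

-- Reachability along a decidable relation on a finite set is decidable:
-- y is reachable from s iff it is reachable in at most n steps (shorten the
-- walk to a simple path), and the latter is a finite search.
module FiniteReachability {n} (R : Rel (Fin n) 0ℓ) (R? : Decidable R) where
  open SimplePaths Fin._≟_ R

  WithinSteps : ℕ → Fin n → Fin n → Set
  WithinSteps zero    s y = s ≡ y
  WithinSteps (suc k) s y = s ≡ y ⊎ ∃[ t ] (R s t × WithinSteps k t y)

  withinSteps? : ∀ k → Decidable (WithinSteps k)
  withinSteps? zero    s y = s Fin.≟ y
  withinSteps? (suc k) s y = (s Fin.≟ y) ⊎-dec Fin.any? (λ t → R? s t ×-dec withinSteps? k t y)

  withinSteps⇒star : ∀ k {s y} → WithinSteps k s y → Star R s y
  withinSteps⇒star zero    refl                  = ε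
  withinSteps⇒star (suc k) (inj₁ refl)           = ε
  withinSteps⇒star (suc k) (inj₂ (_ , r , w))    = r ◅ withinSteps⇒star k w

  withinSteps-suc : ∀ k {s y} → WithinSteps k s y → WithinSteps (suc k) s y
  withinSteps-suc zero    s≡y                = inj₁ s≡y
  withinSteps-suc (suc k) (inj₁ s≡y)         = inj₁ s≡y
  withinSteps-suc (suc k) (inj₂ (t , r , w)) = inj₂ (t , r , withinSteps-suc k w)

  withinSteps-mono : ∀ {j k s y} → j ℕ.≤ k → WithinSteps j s y → WithinSteps k s y
  withinSteps-mono {j} {k} j≤k w with ℕ.≤⇒≤′ j≤k
  ... | ℕ.≤′-refl       = w
  ... | ℕ.≤′-step j≤′k′ = withinSteps-suc _ (withinSteps-mono (ℕ.≤′⇒≤ j≤′k′) w)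

  path⇒withinSteps : ∀ {s xs y} → Linked R (s ∷ xs) → EndsAt (s ∷ xs) y → WithinSteps (length xs) s y
  path⇒withinSteps {xs = []}    [-]     end      = refl
  path⇒withinSteps {xs = _ ∷ _} (r ∷ l) (more e) = inj₂ (_ , r , path⇒withinSteps l e)

  -- a simple path has at most n vertices, hence at most n steps
  star⇒withinSteps : ∀ {s y} → Star R s y → WithinSteps n s y
  star⇒withinSteps w with shorten w
  ... | simplePath xs l u e = withinSteps-mono steps≤n (path⇒withinSteps l e)
    where
    steps≤n : length xs ℕ.≤ n
    steps≤n = ℕ.≤-trans (ℕ.n≤1+n _)
                (ℕ.≤-trans (unique-⊆-length u (λ {x} _ → ∈-allFin x)) (ℕ.≤-reflexive (length-tabulate _)))

  star? : Decidable (Star R)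
  star? s y = map′ (withinSteps⇒star n) star⇒withinSteps (withinSteps? n s y)

count-ones : ∀ {a} {A : Set a} (b : A → Bool) (L : List A) →
             foldr ℕ._+_ 0 (map (λ x → if b x then 1 else 0) L) ≡ length (filterᵇ b L)
count-ones b []      = refl
count-ones b (x ∷ L) with b x
... | true  = ≡.cong suc (count-ones b L)
... | false = count-ones b L

neighbours≤deg : ∀ {n} (G : Graph n) {u L} → Unique L → All (Adj G u) L → length L ℕ.≤ deg G u
neighbours≤deg {n} G {u} {L} L! adjacent = begin
  length L                                     ≤⟨ unique-⊆-length L! L⊆neighbours ⟩
  length (filterᵇ (Graph.adj G u) (allFin n))  ≡⟨ count-ones (Graph.adj G u) (allFin n) ⟨
  deg G u                                      ∎
  where
  open ℕ.≤-Reasoning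
  L⊆neighbours : L ⊆ filterᵇ (Graph.adj G u) (allFin n)
  L⊆neighbours {x} x∈L = ∈-filter⁺ (T? ∘ Graph.adj G u) (∈-allFin x) (Equivalence.from T-≡ (All.lookup adjacent x∈L))

binary-deg≤3 : ∀ {m} {B : Graph m} → IsBinaryTree B → ∀ x → deg B x ℕ.≤ 3
binary-deg≤3 (_ , r , deg-r , deg-other) x with x Fin.≟ r
... | yes refl = ℕ.≤-trans (ℕ.≤-reflexive deg-r) (ℕ.n≤1+n 2)
... | no  x≢r  with deg-other x x≢r
...   | inj₁ deg≡1 = ℕ.≤-trans (ℕ.≤-reflexive deg≡1) (s≤s z≤n)
...   | inj₂ deg≡3 = ℕ.≤-reflexive deg≡3

-- In a quasi-binary tree a vertex has at most three distinct neighbours: the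
-- embedding into a binary tree maps them to distinct neighbours of the image.
quasi-binary-neighbours≤3 : ∀ {n} {T : Graph n} → IsQuasiBinaryTree T →
                            ∀ {u L} → Unique L → All (Adj T u) L → length L ℕ.≤ 3
quasi-binary-neighbours≤3 {T = T} (_ , _ , B , binary , f , f-injective , f-adj) {u} {L} L! adjacent = begin
  length L           ≡⟨ length-map f L ⟨
  length (map f L)   ≤⟨ neighbours≤deg B (Unique.map⁺ (f-injective _ _) L!) (All.map⁺ (All.map f-Adj adjacent)) ⟩
  deg B (f u)        ≤⟨ binary-deg≤3 binary (f u) ⟩
  3                  ∎
  where
  open ℕ.≤-Reasoning
  f-Adj : ∀ {x} → Adj T u x → Adj B (f u) (f x)
  f-Adj {x} = ≡.trans (≡.sym (f-adj u x))

module Sides {n} (T : Graph n) (tree : IsTree T) where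
  open Graph T using (adj)

  adj? : Decidable (Adj T)
  adj? x y = adj x y Bool.≟ true

  Adj-sym : ∀ {x y} → Adj T x y → Adj T y x
  Adj-sym {x} {y} = ≡.trans (Graph.sym T y x)

  Adj-irrefl : ∀ {x y} → Adj T x y → x ≢ y
  Adj-irrefl {x} xy refl with ≡.trans (≡.sym xy) (Graph.irrefl T x)
  ... | ()

  Cut : Fin n → Fin n → Rel (Fin n) 0ℓ
  Cut = AdjWithout T

  cut? : ∀ a b → Decidable (Cut a b)
  cut? a b x y = adj? x y ×-dec ¬? (((x Fin.≟ a) ×-dec (y Fin.≟ b)) ⊎-dec ((x Fin.≟ b) ×-dec (y Fin.≟ a)))

  cut-swap : ∀ {a b x y} → Cut a b x y → Cut b a x y
  cut-swap (xy , ¬ab) = xy , ¬ab ∘ Sum.swap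

  cut-sym : ∀ {a b x y} → Cut a b x y → Cut a b y x
  cut-sym (xy , ¬ab) = Adj-sym xy , λ { (inj₁ (y≡a , x≡b)) → ¬ab (inj₂ (x≡b , y≡a))
                                      ; (inj₂ (y≡b , x≡a)) → ¬ab (inj₁ (x≡a , y≡b)) }

  cut-away : ∀ {a b x y} → Adj T x y → x ≢ a → y ≢ a → Cut a b x y
  cut-away xy x≢a y≢a = xy , λ { (inj₁ (x≡a , _)) → x≢a x≡a ; (inj₂ (_ , y≡a)) → y≢a y≡a }

  cut-into : ∀ {a b x y} → Adj T x y → y ≢ a → y ≢ b → Cut a b x y
  cut-into xy y≢a y≢b = xy , λ { (inj₁ (_ , y≡b)) → y≢b y≡b ; (inj₂ (_ , y≡a)) → y≢a y≡a }

  Side : Fin n → Fin n → Pred (Fin n) 0ℓ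
  Side u v x = Star (Cut u v) u x

  side? : ∀ u v → Relation.Unary.Decidable (Side u v)
  side? u v = FiniteReachability.star? (Cut u v) (cut? u v) u

  -- Acyclicity: the far end v of an edge uv is not on the side of u,
  -- since a simple path from u to v in T − uv closes a cycle with uv.
  far-end-excluded : ∀ {u v} → Adj T u v → ¬ Side u v v
  far-end-excluded {u} {v} uv walk with SimplePaths.shorten Fin._≟_ (Cut u v) walk
  ... | SimplePaths.simplePath xs path unique ends =
    proj₂ tree (u ∷ xs) (two-steps xs path ends , unique , linked-snoc (Linked.map proj₁ path) ends (Adj-sym uv))
    where
    two-steps : ∀ xs → Linked (Cut u v) (u ∷ xs) → EndsAt (u ∷ xs) v → 2 ℕ.≤ length xs
    two-steps []          _          end        = contradiction refl (Adj-irrefl uv)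
    two-steps (_ ∷ [])    (step ∷ _) (more end) = contradiction (inj₁ (refl , refl)) (proj₂ step)
    two-steps (_ ∷ _ ∷ _) _          _          = s≤s (s≤s z≤n)

  sides-disjoint : ∀ {u v x} → Adj T u v → Side u v x → Side v u x → ⊥
  sides-disjoint uv ux vx = far-end-excluded uv (ux ◅◅ Star.reverse (cut-sym ∘ cut-swap) vx)

  -- Connectivity: walking from u, every vertex reached lies on one of the two sides.
  sides-cover : ∀ {u v} → Adj T u v → ∀ x → Side u v x ⊎ Side v u x
  sides-cover {u} {v} uv x = invariant-along step (inj₁ ε) (proj₁ tree u x)
    where
    step : ∀ {y z} → Side u v y ⊎ Side v u y → Adj T y z → Side u v z ⊎ Side v u z
    step {y} {z} inside yz with z Fin.≟ u | z Fin.≟ v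
    ... | yes refl | _        = inj₁ ε
    ... | no _     | yes refl = inj₂ ε
    ... | no z≢u   | no z≢v   = Sum.map (λ p → p ◅◅ (cut-into yz z≢u z≢v ◅ ε))
                                        (λ q → q ◅◅ (cut-into yz z≢v z≢u ◅ ε)) inside

  Child : Fin n → Fin n → Pred (Fin n) 0ℓ
  Child u v c = Adj T u c × c ≢ v

  -- Every vertex on the side of uv other than u lies on the side of cu for a child c:
  -- follow the walk from u, which leaves u towards some child and stays beneath it
  -- until it returns to u.
  side-decompose : ∀ {u v x} → Side u v x → x ≡ u ⊎ ∃[ c ] (Child u v c × Side c u x)
  side-decompose {u} {v} = invariant-along step (inj₁ refl)
    where
    step : ∀ {y z} → y ≡ u ⊎ ∃[ c ] (Child u v c × Side c u y) → Cut u v y z →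
           z ≡ u ⊎ ∃[ c ] (Child u v c × Side c u z)
    step {y} {z} below yz with z Fin.≟ u | y Fin.≟ u | below
    ... | yes z≡u | _        | _                        = inj₁ z≡u
    ... | no _    | yes refl | _                        = inj₂ (z , (proj₁ yz , λ z≡v → proj₂ yz (inj₁ (refl , z≡v))) , ε)
    ... | no _    | no y≢u   | inj₁ y≡u                 = contradiction y≡u y≢u
    ... | no z≢u  | no y≢u   | inj₂ (c , child , cy)    = inj₂ (c , child , cy ◅◅ (cut-swap (cut-away (proj₁ yz) y≢u z≢u) ◅ ε))

  -- The side of a child edge cu lies inside the side of uv: a walk from c avoiding
  -- the edge cu never meets u, so prefixed by the step u → c it avoids uv.
  child-side-⊆ : ∀ {u v c x} → Child u v c → Side c u x → Side u v x
  child-side-⊆ {u} {v} {c} (uc , c≢v) cx = proj₂ (invariant-along step (ε , (first ◅ ε)) cx)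
    where
    u∉side : ∀ {y} → Side c u y → y ≢ u
    u∉side cy refl = sides-disjoint (Adj-sym uc) cy ε
    first : Cut u v u c
    first = cut-into uc (Adj-irrefl uc ∘ ≡.sym) c≢v
    step : ∀ {y z} → Side c u y × Side u v y → Cut c u y z → Side c u z × Side u v z
    step (cy , uy) yz = let cz = cy ◅◅ (yz ◅ ε) in
      cz , uy ◅◅ (cut-away (proj₁ yz) (u∉side cy) (u∉side cz) ◅ ε)

  child-sides-disjoint : ∀ {u c d x} → Adj T u c → Adj T u d → c ≢ d → Side c u x → Side d u x → ⊥
  child-sides-disjoint uc ud c≢d cx dx = sides-disjoint uc (child-side-⊆ (ud , c≢d ∘ ≡.sym) dx) cx

  child? : ∀ u v → Relation.Unary.Decidable (Child u v)
  child? u v c = adj? u c ×-dec ¬? (c Fin.≟ v)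

  children : Fin n → Fin n → List (Fin n)
  children u v = filter (child? u v) (allFin n)

  children-unique : ∀ u v → Unique (children u v)
  children-unique u v = Unique.filter⁺ (child? u v) (Unique.allFin⁺ n)

  ∈-children⁻ : ∀ {u v c} → c ∈ children u v → Child u v c
  ∈-children⁻ {u} {v} = proj₂ ∘ ∈-filter⁻ (child? u v) {xs = allFin n}

  ∈-children⁺ : ∀ {u v c} → Child u v c → c ∈ children u v
  ∈-children⁺ {u} {v} {c} = ∈-filter⁺ (child? u v) (∈-allFin c)

  sideList : Fin n → Fin n → List (Fin n)
  sideList u v = filter (side? u v) (allFin n)

  ∈-sideList⁻ : ∀ {u v x} → x ∈ sideList u v → Side u v x
  ∈-sideList⁻ {u} {v} = proj₂ ∘ ∈-filter⁻ (side? u v) {xs = allFin n}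

  ∈-sideList⁺ : ∀ {u v x} → Side u v x → x ∈ sideList u v
  ∈-sideList⁺ {u} {v} {x} = ∈-filter⁺ (side? u v) (∈-allFin x)

  sideSize : Fin n → Fin n → ℕ
  sideSize u v = length (sideList u v)

  -- The side of a child edge is strictly smaller: it is contained in the side
  -- of uv and misses u.
  child-side-smaller : ∀ {u v c} → Child u v c → sideSize c u < sideSize u v
  child-side-smaller {u} {v} {c} child@(uc , _) =
    unique-⊆-length (u∉ ∷ Unique.filter⁺ (side? c u) (Unique.allFin⁺ n)) contained
    where
    u∉ : All (u ≢_) (sideList c u)
    u∉ = All.tabulate λ { x∈ refl → sides-disjoint (Adj-sym uc) (∈-sideList⁻ x∈) ε }
    contained : u ∷ sideList c u ⊆ sideList u v
    contained (here refl) = ∈-sideList⁺ ε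
    contained (there x∈)  = ∈-sideList⁺ (child-side-⊆ child (∈-sideList⁻ x∈))

module Weights {c ℓ ℓ₂} (R : OrderedCommRing c ℓ ℓ₂) {n} (T : Graph n) (tree : IsTree T)
               (ω : Fin n → OrderedCommRing.Carrier R) where
  open OrderedCommRing R hiding (refl; sym; trans)
  open OrderedCommRing R using () renaming (refl to ≈-refl; sym to ≈-sym; trans to ≈-trans)
  open Sides T tree
  open ListSum +-commutativeMonoid
  open import Relation.Binary.Reasoning.Setoid setoid

  side : Fin n → Fin n → Fin n → Bool
  side u v x = does (side? u v x)

  side-spec : ∀ u v x → (side u v x ≡ true → Side u v x) × (Side u v x → side u v x ≡ true)
  side-spec u v x = witness (side? u v x) , dec-true (side? u v x)
    where
    witness : ∀ {P : Set} (P? : Dec P) → does P? ≡ true → P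
    witness (yes p) _  = p
    witness (no _)  ()

  W : Fin n → Fin n → Carrier
  W u v = weightOf R ω (side u v)

  mass : (Fin n → Bool) → Fin n → Carrier
  mass S x = if S x then ω x else 0#

  mass-in : ∀ {S x} → S x ≡ true → mass S x ≈ ω x
  mass-in {S} {x} Sx rewrite Sx = ≈-refl

  mass-out : ∀ {S x} → S x ≡ false → mass S x ≈ 0#
  mass-out {S} {x} Sx rewrite Sx = ≈-refl

  mass-side-in : ∀ {u v x} → Side u v x → mass (side u v) x ≈ ω x
  mass-side-in {u} {v} {x} = mass-in {side u v} ∘ dec-true (side? u v x)

  mass-side-out : ∀ {u v x} → ¬ Side u v x → mass (side u v) x ≈ 0#
  mass-side-out {u} {v} {x} = mass-out {side u v} ∘ dec-false (side? u v x)

  is : Fin n → Fin n → Bool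
  is u x = does (x Fin.≟ u)

  weight-singleton : ∀ u → weightOf R ω (is u) ≈ ω u
  weight-singleton u = ≈-trans (sumOver-single (Unique.allFin⁺ n) (∈-allFin u) (λ {y} _ → mass-out {is u} ∘ dec-false (y Fin.≟ u)))
                               (mass-in {is u} (dec-true (u Fin.≟ u) refl))

  -- Each vertex lies on exactly one side of an edge, so the two weights add up to ω(T).
  sides-partition : ∀ {u v} → Adj T u v → W u v + W v u ≈ totalWeight R ω
  sides-partition {u} {v} uv = ≈-trans (≈-sym (sumOver-+ (allFin n) (mass (side u v)) (mass (side v u))))
                                     (sumOver-cong (allFin n) split)
    where
    split : ∀ x → mass (side u v) x + mass (side v u) x ≈ ω x
    split x with sides-cover uv x
    ... | inj₁ ux = ≈-trans (+-cong (mass-side-in ux) (mass-side-out (sides-disjoint uv ux))) (+-identityʳ _)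
    ... | inj₂ vx = ≈-trans (+-cong (mass-side-out (λ ux → sides-disjoint uv ux vx)) (mass-side-in vx)) (+-identityˡ _)

  -- Pointwise form of "the side of uv is {u} together with the pairwise
  -- disjoint sides of the child edges cu".
  Decomposes : Fin n → Fin n → Fin n → Set ℓ
  Decomposes u v x = mass (side u v) x ≈ mass (is u) x + sumOver (children u v) (λ c → mass (side c u) x)

  -- u lies on the side of uv but on no child side
  decomposes-at-root : ∀ u v → Decomposes u v u
  decomposes-at-root u v = begin
    mass (side u v) u                                   ≈⟨ mass-side-in ε ⟩
    ω u                                                 ≈⟨ +-identityʳ (ω u) ⟨
    ω u + 0#                                            ≈⟨ +-cong (mass-in {is u} (dec-true (u Fin.≟ u) refl)) (sumOver-0 (children u v) u∉children) ⟨
    mass (is u) u + sumOver (children u v) (λ c → mass (side c u) u) ∎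
    where
    u∉children : ∀ {c} → c ∈ children u v → mass (side c u) u ≈ 0#
    u∉children c∈ = mass-side-out (λ cu → sides-disjoint (Adj-sym (proj₁ (∈-children⁻ c∈))) cu ε)

  -- a vertex on the side of the child c lies on no other child side
  decomposes-below : ∀ {u v c x} → Child u v c → Side c u x → Decomposes u v x
  decomposes-below {u} {v} {c} {x} child cx = begin
    mass (side u v) x                                   ≈⟨ mass-side-in (child-side-⊆ child cx) ⟩
    ω x                                                 ≈⟨ mass-side-in cx ⟨
    mass (side c u) x                                   ≈⟨ sumOver-single (children-unique u v) (∈-children⁺ child) elsewhere ⟨
    sumOver (children u v) (λ d → mass (side d u) x)    ≈⟨ +-identityˡ _ ⟨
    0# + sumOver (children u v) (λ d → mass (side d u) x) ≈⟨ +-congʳ (mass-out {is u} (dec-false (x Fin.≟ u) x≢u)) ⟨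
    mass (is u) x + sumOver (children u v) (λ d → mass (side d u) x) ∎
    where
    x≢u : x ≢ u
    x≢u refl = sides-disjoint (Adj-sym (proj₁ child)) cx ε
    elsewhere : ∀ {d} → d ∈ children u v → d ≢ c → mass (side d u) x ≈ 0#
    elsewhere d∈ d≢c = mass-side-out (λ dx → child-sides-disjoint (proj₁ (∈-children⁻ d∈)) (proj₁ child) d≢c dx cx)

  -- a vertex off the side of uv lies on no child side
  decomposes-outside : ∀ {u v x} → ¬ Side u v x → Decomposes u v x
  decomposes-outside {u} {v} {x} ¬ux = begin
    mass (side u v) x                                   ≈⟨ mass-side-out ¬ux ⟩
    0#                                                  ≈⟨ +-identityʳ 0# ⟨
    0# + 0#                                             ≈⟨ +-cong (mass-out {is u} (dec-false (x Fin.≟ u) x≢u)) (sumOver-0 (children u v) outside) ⟨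
    mass (is u) x + sumOver (children u v) (λ c → mass (side c u) x) ∎
    where
    x≢u : x ≢ u
    x≢u refl = ¬ux ε
    outside : ∀ {c} → c ∈ children u v → mass (side c u) x ≈ 0#
    outside c∈ = mass-side-out (¬ux ∘ child-side-⊆ (∈-children⁻ c∈))

  decomposes : ∀ u v x → Decomposes u v x
  decomposes u v x = by-cases x (side? u v x)
    where
    by-cases : ∀ x → Dec (Side u v x) → Decomposes u v x
    by-cases x (no ¬ux) = decomposes-outside ¬ux
    by-cases x (yes ux) with side-decompose ux
    ... | inj₁ refl                = decomposes-at-root u v
    ... | inj₂ (c , child , cx)    = decomposes-below child cx

  weight-decompose : ∀ u v → W u v ≈ ω u + sumOver (children u v) (λ c → W c u)
  weight-decompose u v = begin
    W u v
      ≈⟨ sumOver-cong (allFin n) (decomposes u v) ⟩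
    sumOver (allFin n) (λ x → mass (is u) x + sumOver (children u v) (λ c → mass (side c u) x))
      ≈⟨ sumOver-+ (allFin n) (mass (is u)) _ ⟩
    weightOf R ω (is u) + sumOver (allFin n) (λ x → sumOver (children u v) (λ c → mass (side c u) x))
      ≈⟨ +-cong (weight-singleton u) (sumOver-swap (allFin n) (children u v) (λ x c → mass (side c u) x)) ⟩
    ω u + sumOver (children u v) (λ c → W c u) ∎

entry-or-all : ∀ {a p q} {A : Set a} {P : Pred A p} {Q : Pred A q} →
               (∀ x → P x ⊎ Q x) → ∀ L → (∃[ x ] (x ∈ L × P x)) ⊎ All Q L
entry-or-all choose []      = inj₂ []
entry-or-all choose (x ∷ L) with choose x | entry-or-all choose L
... | inj₁ px | _                  = inj₁ (x , here refl , px)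
... | inj₂ _  | inj₁ (y , y∈ , py) = inj₁ (y , there y∈ , py)
... | inj₂ qx | inj₂ qs            = inj₂ (qx ∷ qs)

module OrderedCommRingProperties {c ℓ ℓ₂} (R : OrderedCommRing c ℓ ℓ₂) where
  open OrderedCommRing R

  totalOrder : TotalOrder c ℓ ℓ₂
  totalOrder = record { isTotalOrder = isTotalOrder }

  open TotalOrder totalOrder public using (total; poset)
  open import Relation.Binary.Reasoning.PartialOrder poset

  +-monoˡ-≤ : ∀ {x y} z → x ≤ y → (z + x) ≤ (z + y)
  +-monoˡ-≤ {x} {y} z x≤y = begin
    z + x  ≈⟨ +-comm z x ⟩
    x + z  ≤⟨ +-monoʳ-≤ z x≤y ⟩
    y + z  ≈⟨ +-comm y z ⟩
    z + y  ∎

  +-mono-≤ : ∀ {x y z w} → x ≤ y → z ≤ w → (x + z) ≤ (y + w)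
  +-mono-≤ {x} {y} {z} {w} x≤y z≤w = begin
    x + z  ≤⟨ +-monoʳ-≤ z x≤y ⟩
    y + z  ≤⟨ +-monoˡ-≤ y z≤w ⟩
    y + w  ∎

  +-cancelʳ-≤ : ∀ {x y} z → (x + z) ≤ (y + z) → x ≤ y
  +-cancelʳ-≤ {x} {y} z x+z≤y+z = begin
    x                ≈⟨ cancel x ⟨
    (x + z) + - z    ≤⟨ +-monoʳ-≤ (- z) x+z≤y+z ⟩
    (y + z) + - z    ≈⟨ cancel y ⟩
    y                ∎
    where
    cancel : ∀ t → (t + z) + - z ≈ t
    cancel t = trans (+-assoc t z (- z)) (trans (+-congˡ (-‿inverseʳ z)) (+-identityʳ t))

-- A connected graph on at least two vertices has an edge: the first step of
-- a walk between two distinct vertices.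
edge-exists : ∀ {n} (G : Graph (suc (suc n))) → Connected G → ∃[ u ] ∃[ v ] Adj G u v
edge-exists G connected with connected Fin.zero (Fin.suc Fin.zero)
... | uv ◅ _ = _ , _ , uv

module Descent {c ℓ ℓ₂} (R : OrderedCommRing c ℓ ℓ₂) where
  open OrderedCommRing R
  open OrderedCommRingProperties R
  open ListSum +-commutativeMonoid using (sumOver)

  module _ {n} (T : Graph n) (quasi : IsQuasiBinaryTree T) (ω : Fin n → Carrier) (γ η : Carrier)
           (bound₃ : ωBoundedBy R T ω 3 γ)
           (bound₁ : ωBoundedBy R T ω 1 ((η + η) + γ))
           (bound₂ : ωBoundedBy R T ω 2 (η + γ)) where
    open Sides T (proj₁ quasi)
    open Weights R T (proj₁ quasi) ω
    open import Relation.Binary.Reasoning.PartialOrder poset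

    BalancedEdge : Set _
    BalancedEdge = Σ (Fin n) λ u → Σ (Fin n) λ v → Adj T u v ×
      Σ (Fin n → Bool) λ S →
        (∀ x → (S x ≡ true → Star (AdjWithout T u v) u x) × (Star (AdjWithout T u v) u x → S x ≡ true)) ×
        (η ≤ weightOf R ω S) × (weightOf R ω S ≤ ((η + η) + γ))

    -- The degree-dependent bounds on ω(u) absorb at most two light child sides;
    -- u has its parent and the children in cs as distinct neighbours.
    degree-bound : ∀ {u} cs → All (λ c → W c u ≤ η) cs →
                   suc (length cs) ℕ.≤ deg T u → suc (length cs) ℕ.≤ 3 →
                   (ω u + sumOver cs (λ c → W c u)) ≤ ((η + η) + γ)
    degree-bound {u} [] [] deg≥1 _ = begin
      ω u + 0#       ≈⟨ +-identityʳ (ω u) ⟩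
      ω u            ≤⟨ bound₁ u deg≥1 ⟩
      (η + η) + γ    ∎
    degree-bound {u} (c ∷ []) (light ∷ []) deg≥2 _ = begin
      ω u + (W c u + 0#)   ≈⟨ +-congˡ (+-identityʳ (W c u)) ⟩
      ω u + W c u          ≤⟨ +-mono-≤ (bound₂ u deg≥2) light ⟩
      (η + γ) + η          ≈⟨ +-assoc η γ η ⟩
      η + (γ + η)          ≈⟨ +-congˡ (+-comm γ η) ⟩
      η + (η + γ)          ≈⟨ +-assoc η η γ ⟨
      (η + η) + γ          ∎
    degree-bound {u} (c ∷ d ∷ []) (light-c ∷ light-d ∷ []) deg≥3 _ = begin
      ω u + (W c u + (W d u + 0#))   ≈⟨ +-congˡ (+-congˡ (+-identityʳ (W d u))) ⟩
      ω u + (W c u + W d u)          ≤⟨ +-mono-≤ (bound₃ u deg≥3) (+-mono-≤ light-c light-d) ⟩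
      γ + (η + η)                    ≈⟨ +-comm γ (η + η) ⟩
      (η + η) + γ                    ∎
    degree-bound (_ ∷ _ ∷ _ ∷ _) _ _ (s≤s (s≤s (s≤s ())))

    light-children-bound : ∀ {u v} → Adj T u v → All (λ c → W c u ≤ η) (children u v) →
                           W u v ≤ ((η + η) + γ)
    light-children-bound {u} {v} uv light = begin
      W u v                                       ≈⟨ weight-decompose u v ⟩
      ω u + sumOver (children u v) (λ c → W c u)  ≤⟨ degree-bound (children u v) light
                                                       (neighbours≤deg T neighbours! adjacent)
                                                       (quasi-binary-neighbours≤3 quasi neighbours! adjacent) ⟩
      (η + η) + γ                                 ∎
      where
      neighbours! : Unique (v ∷ children u v)
      neighbours! = All.tabulate (λ c∈ v≡c → proj₂ (∈-children⁻ c∈) (≡.sym v≡c)) ∷ children-unique u v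
      adjacent : All (Adj T u) (v ∷ children u v)
      adjacent = uv ∷ All.tabulate (proj₁ ∘ ∈-children⁻)

    -- Descent: move from a heavy side into a heavy child side while there is one;
    -- the sides shrink strictly, and where no child is heavy the side is balanced.
    descend : ∀ {u v} → Adj T u v → η ≤ W u v → Acc _<_ (sideSize u v) → BalancedEdge
    descend {u} {v} uv heavy (acc smaller) with entry-or-all (λ c → total η (W c u)) (children u v)
    ... | inj₁ (c , c∈ , heavy-c) = descend (Adj-sym (proj₁ child)) heavy-c (smaller (child-side-smaller child))
      where child = ∈-children⁻ c∈
    ... | inj₂ light = u , v , uv , side u v , side-spec u v , heavy , light-children-bound uv light

    -- One orientation of any edge is heavy, as the two side weights add up to ω(T) ≥ 2η.
    heavy-orientation : (η + η) ≤ totalWeight R ω → ∀ {u v} → Adj T u v →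
                        ∃[ u′ ] ∃[ v′ ] (Adj T u′ v′ × η ≤ W u′ v′)
    heavy-orientation heavy-total {u} {v} uv with total η (W v u)
    ... | inj₁ η≤Wvu = v , u , Adj-sym uv , η≤Wvu
    ... | inj₂ Wvu≤η = u , v , uv , +-cancelʳ-≤ η (begin
      η + η             ≤⟨ heavy-total ⟩
      totalWeight R ω   ≈⟨ sides-partition uv ⟨
      W u v + W v u     ≤⟨ +-monoˡ-≤ (W u v) Wvu≤η ⟩
      W u v + η         ∎)

    balanced-edge : (η + η) ≤ totalWeight R ω → ∀ {u v} → Adj T u v → BalancedEdge
    balanced-edge heavy-total uv with heavy-orientation heavy-total uv
    ... | u , v , uv′ , heavy = descend uv′ heavy (ℕ.<-wellFounded (sideSize u v))

lemma1 : ∀ {c ℓ ℓ₂} (R : OrderedCommRing c ℓ ℓ₂) →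
    let open OrderedCommRing R in
    ∀ {n : ℕ} (T : Graph n) → IsQuasiBinaryTree T → 1 < n →
    (ω : Fin n → Carrier) (γ η : Carrier) →
    ωBoundedBy R T ω 3 γ →
    ωBoundedBy R T ω 1 ((η + η) + γ) →
    ωBoundedBy R T ω 2 (η + γ) →
    (η + η) ≤ totalWeight R ω →
    Σ (Fin n) λ u → Σ (Fin n) λ v → Adj T u v ×
      Σ (Fin n → Bool) λ S →
        (∀ x → (S x ≡ true → Star (AdjWithout T u v) u x) × (Star (AdjWithout T u v) u x → S x ≡ true)) ×
        (η ≤ weightOf R ω S) × (weightOf R ω S ≤ ((η + η) + γ))
lemma1 R T quasi (s≤s (s≤s _)) ω γ η bound₃ bound₁ bound₂ heavy-total =
  let _ , _ , uv = edge-exists T (proj₁ (proj₁ quasi))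
  in Descent.balanced-edge R T quasi ω γ η bound₃ bound₁ bound₂ heavy-total uv
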